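{- Let $\mathcal{C}$ be a permutation class that contains only finitely many zigzag permutations. Then $\mathcal{C}$ is contained in $\mathsf{Grid}(\mathcal{M})$ for some gridding matrix $\mathcal{M}$ comprising a single row, in which each entry is $\mathsf{Av}(21)$ or $\mathsf{Av}(12)$.
   Context: A permutation of length $n$ is an ordering $\pi=\pi(1)\cdots\pi(n)$ of $[n]$; containment of permutations is the usual pattern containment (a subsequence order isomorphic to the smaller permutation), and a permutation class is a set of permutations closed downwards under containment. $\mathsf{Av}(21)=\{1,12,123,\dots\}$ is the class of increasing permutations and $\mathsf{Av}(12)=\{1,21,321,\dots\}$ is the class of decreasing permutations. A zigzag permutation is a permutation $\pi$ of length $n$ with no $i\in[n-2]$ such that $\pi(i)\pi(i+1)\pi(i+2)$ is monotone increasing or decreasing. For a matrix $\mathcal{M}$ whose entries are permutation classes (or empty), $\mathsf{Grid}(\mathcal{M})$ is the set of permutations whose plot can be divided by horizontal and vertical lines into a grid of cells of the same dimensions as $\mathcal{M}$ such that the entries in each cell are order isomorphic to a permutation in the class in the corresponding cell of $\mathcal{M}$ (for a single-row matrix $[\mathcal{E}_1\ \cdots\ \mathcal{E}_k]$ this means $\pi$ is a concatenation of $k$ consecutive, possibly empty, segments, the $i$-th of which is order isomorphic to a member of $\mathcal{E}_i$). -}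

module Defs where

open import Data.Nat using (ℕ; suc)
open import Data.Fin using (Fin; toℕ; _<_; _>_; _≤_)
open import Data.Product using (Σ; _×_; ∃; proj₂)
open import Data.List using (List)
open import Data.List.Relation.Unary.Any using (Any)
open import Relation.Binary.PropositionalEquality using (_≡_)
open import Relation.Nullary using (¬_)
open import Function.Definitions using (Injective)

-- A permutation of length n: an injective (hence bijective) map [n] → [n],
-- written in one-line notation π(0) π(1) … π(n-1) (0-indexed).
record Perm (n : ℕ) : Set where
  constructor perm
  field
    fun : Fin n → Fin n
    inj : Injective _≡_ _≡_ fun
open Perm public

_≼_ : ∀ {k n} → Perm k → Perm n → Set
_≼_ {k} {n} σ π =
  Σ (Fin k → Fin n) λ f →
    (∀ i j → i < j → f i < f j) ×
    (∀ i j → (fun σ i < fun σ j → fun π (f i) < fun π (f j)) ×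
             (fun π (f i) < fun π (f j) → fun σ i < fun σ j))

PermSet : Set₁
PermSet = ∀ {n} → Perm n → Set

IsClass : PermSet → Set
IsClass C = ∀ {k n} (σ : Perm k) (π : Perm n) → C π → σ ≼ π → C σ

Zigzag : ∀ {n} → Perm n → Set
Zigzag {n} π = ∀ (i j k : Fin n) → toℕ j ≡ suc (toℕ i) → toℕ k ≡ suc (toℕ j) →
  ¬ (fun π i < fun π j × fun π j < fun π k) ×
  ¬ (fun π i > fun π j × fun π j > fun π k)

_≋_ : ∀ {m n} → Perm m → Perm n → Set
_≋_ {m} {n} σ π = (m ≡ n) × (∀ (i : Fin m) (j : Fin n) → toℕ i ≡ toℕ j → toℕ (fun σ i) ≡ toℕ (fun π j))

AnyPerm : Set
AnyPerm = Σ ℕ Perm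

FinitelyManyZigzags : PermSet → Set
FinitelyManyZigzags C = ∃ λ (L : List AnyPerm) →
  ∀ {n} (π : Perm n) → C π → Zigzag π → Any (λ p → proj₂ p ≋ π) L

data Mono : Set where
  Av21 Av12 : Mono

CellOrder : Mono → ∀ {n} → Fin n → Fin n → Set
CellOrder Av21 a b = a < b
CellOrder Av12 a b = a > b

-- Grid of a single-row matrix M = [M 0 ⋯ M (k-1)]: π is a concatenation of k
-- consecutive (possibly empty) segments, the c-th being increasing (Av(21)) or
-- decreasing (Av(12)) according to M c.
InGrid : ∀ {k} → (Fin k → Mono) → ∀ {n} → Perm n → Set
InGrid {k} M {n} π = Σ (Fin n → Fin k) λ col →
  (∀ i j → i ≤ j → col i ≤ col j) ×
  (∀ i j → i < j → col i ≡ col j → CellOrder (M (col i)) (fun π i) (fun π j))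

-- Split π at its turning points (the entries where an ascent turns into a descent or back)
-- into monotone runs of alternating direction. Sending each run to the next column of the row
-- Av(21) Av(12) Av(21) … whose type matches grids π with at most two more columns than π has
-- turning points (the first column may stay empty). The turning points together with the first
-- and last entries of π form a zigzag pattern of π; as C contains only finitely many zigzags,
-- their lengths are bounded by some B, so B + 1 columns suffice for every π in C.
module Submission where

open import Defs
open import Data.Bool.Properties using (T-≡)
open import Data.Fin as Fin using (Fin; toℕ; fromℕ<)
open import Data.Fin.Properties as Finₚ using (toℕ-injective; toℕ-fromℕ<; fromℕ<-toℕ; toℕ<n)
open import Data.Fin.Subset using (Subset; _∈_; _∉_; ∣_∣)
open import Data.Fin.Subset.Properties using (p⊂q⇒∣p∣<∣q∣; ∣⊤∣≡n; ∈⊤)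
open import Data.List using (map)
open import Data.List.Extrema.Nat using (max; v≤max⁺)
import Data.List.Relation.Unary.Any as Any
open import Data.List.Relation.Unary.Any.Properties using (map⁺)
open import Data.Nat using (ℕ; zero; suc; _+_; _<_; _≤_; _<ᵇ_; _<?_; z≤n; s≤s)
open import Data.Nat.Properties
  using ( <-trans; <-asym; <-irrefl; <-cmp; <⇒≢; ≤∧≢⇒<; ≮⇒≥; <ᵇ⇒<; <⇒<ᵇ; ≤-refl; ≤-reflexive
        ; ≤-trans; ≤-antisym; <-≤-trans; ≤-pred; m≤n⇒m<n∨m≡n; n≤1+n; n<1+n; +-identityʳ; +-suc
        ; +-monoˡ-≤ )
open import Data.Product using (Σ; _×_; _,_; proj₁; proj₂)
open import Data.Sum using (_⊎_; inj₁; inj₂)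
open import Data.Vec using (tabulate)
open import Data.Vec.Properties using (lookup∘tabulate; []=⇒lookup; lookup⇒[]=)
open import Function using (id; _∘_; Equivalence)
open import Function.Definitions using (Injective)
open import Relation.Binary.Definitions using (tri<; tri≈; tri>)
open import Relation.Binary.PropositionalEquality
open import Relation.Nullary using (¬_; Dec; yes; no; contradiction)

Step : Mono → ℕ → ℕ → Set
Step Av21 a b = a < b
Step Av12 a b = b < a

Step⇒CellOrder : ∀ d {n} {a b : Fin n} → Step d (toℕ a) (toℕ b) → CellOrder d a b
Step⇒CellOrder Av21 a<b = a<b
Step⇒CellOrder Av12 b<a = b<a

Step-trans : ∀ d {a b c} → Step d a b → Step d b c → Step d a c
Step-trans Av21 a<b b<c = <-trans a<b b<c
Step-trans Av12 b<a c<b = <-trans c<b b<a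

opposite : Mono → Mono
opposite Av21 = Av12
opposite Av12 = Av21

turn-nonmonotone : ∀ d {a b c} → Step d a b → Step (opposite d) b c →
  ¬ (a < b × b < c) × ¬ (b < a × c < b)
turn-nonmonotone Av21 a<b c<b = (λ (_ , b<c) → <-asym b<c c<b) , (λ (b<a , _) → <-asym a<b b<a)
turn-nonmonotone Av12 b<a b<c = (λ (a<b , _) → <-asym a<b b<a) , (λ (_ , c<b) → <-asym b<c c<b)

_≟ᴹ_ : (d e : Mono) → Dec (d ≡ e)
Av21 ≟ᴹ Av21 = yes refl
Av21 ≟ᴹ Av12 = no λ ()
Av12 ≟ᴹ Av21 = no λ ()
Av12 ≟ᴹ Av12 = yes refl

≢⇒≡opposite : ∀ {d e} → d ≢ e → d ≡ opposite e
≢⇒≡opposite {Av21} {Av21} d≢e = contradiction refl d≢e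
≢⇒≡opposite {Av21} {Av12} _   = refl
≢⇒≡opposite {Av12} {Av21} _   = refl
≢⇒≡opposite {Av12} {Av12} d≢e = contradiction refl d≢e

direction : ℕ → ℕ → Mono
direction a b with a <? b
... | yes _ = Av21
... | no  _ = Av12

Step-direction : ∀ {a b} → a ≢ b → Step (direction a b) a b
Step-direction {a} {b} a≢b with a <? b
... | yes a<b = a<b
... | no  a≮b = ≤∧≢⇒< (≮⇒≥ a≮b) (≢-sym a≢b)

cellType : ℕ → Mono
cellType zero    = Av21
cellType (suc c) = opposite (cellType c)

module Flatten {m} (w : Fin m → ℕ) (w-injective : Injective _≡_ _≡_ w) where

  below : Fin m → Subset m
  below i = tabulate λ j → w j <ᵇ w i

  ∈below⁺ : ∀ {i j} → w j < w i → j ∈ below i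
  ∈below⁺ {i} {j} wj<wi =
    lookup⇒[]= j (below i) (trans (lookup∘tabulate _ j) (Equivalence.to T-≡ (<⇒<ᵇ wj<wi)))

  ∈below⁻ : ∀ {i j} → j ∈ below i → w j < w i
  ∈below⁻ {i} {j} j∈below = <ᵇ⇒< (w j) (w i)
    (Equivalence.from T-≡ (trans (sym (lookup∘tabulate _ j)) ([]=⇒lookup j∈below)))

  ∉below-self : ∀ i → i ∉ below i
  ∉below-self i i∈below = <-irrefl refl (∈below⁻ i∈below)

  rank : Fin m → ℕ
  rank i = ∣ below i ∣

  rank<m : ∀ i → rank i < m
  rank<m i = subst (rank i <_) (∣⊤∣≡n m) (p⊂q⇒∣p∣<∣q∣ ((λ _ → ∈⊤) , i , ∈⊤ , ∉below-self i))

  rank-mono : ∀ {i j} → w i < w j → rank i < rank j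
  rank-mono {i} {j} wi<wj = p⊂q⇒∣p∣<∣q∣
    ((λ k∈below → ∈below⁺ (<-trans (∈below⁻ k∈below) wi<wj)) , i , ∈below⁺ wi<wj , ∉below-self i)

  rank-reflect : ∀ {i j} → rank i < rank j → w i < w j
  rank-reflect {i} {j} ri<rj with <-cmp (w i) (w j)
  ... | tri< wi<wj _ _ = wi<wj
  ... | tri≈ _ wi≡wj _ = contradiction (cong rank (w-injective wi≡wj)) (<⇒≢ ri<rj)
  ... | tri> _ _ wj<wi = contradiction (rank-mono wj<wi) (<-asym ri<rj)

  rank-injective : ∀ {i j} → rank i ≡ rank j → i ≡ j
  rank-injective {i} {j} ri≡rj with <-cmp (w i) (w j)
  ... | tri< wi<wj _ _ = contradiction ri≡rj (<⇒≢ (rank-mono wi<wj))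
  ... | tri≈ _ wi≡wj _ = w-injective wi≡wj
  ... | tri> _ _ wj<wi = contradiction (sym ri≡rj) (<⇒≢ (rank-mono wj<wi))

  flatten : Perm m
  flatten = perm (λ i → fromℕ< (rank<m i)) λ {i} {j} eq →
    rank-injective (trans (sym (toℕ-fromℕ< (rank<m i))) (trans (cong toℕ eq) (toℕ-fromℕ< (rank<m j))))

  flatten-order : ∀ i j → (fun flatten i Fin.< fun flatten j → w i < w j) ×
                          (w i < w j → fun flatten i Fin.< fun flatten j)
  flatten-order i j rewrite toℕ-fromℕ< (rank<m i) | toℕ-fromℕ< (rank<m j) = rank-reflect , rank-mono

snoc : {A : Set} → (ℕ → A) → ℕ → A → ℕ → A
snoc f k x j with j <? k
... | yes _ = f j
... | no  _ = x

snoc-< : ∀ {A : Set} {k j} (f : ℕ → A) x → j < k → snoc f k x j ≡ f j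
snoc-< {k = k} {j} f x j<k with j <? k
... | yes _   = refl
... | no  j≮k = contradiction j<k j≮k

snoc-≡ : ∀ {A : Set} (f : ℕ → A) k x → snoc f k x k ≡ x
snoc-≡ f k x with k <? k
... | yes k<k = contradiction k<k (<-irrefl refl)
... | no  _   = refl

module Runs (v : ℕ → ℕ) (adjacent-distinct : ∀ s → v s ≢ v (suc s)) where

  stepDirection : ℕ → Mono
  stepDirection s = direction (v s) (v (suc s))

  column : ℕ → ℕ
  column zero = zero
  column (suc s) with stepDirection s ≟ᴹ cellType (column s)
  ... | yes _ = column s
  ... | no  _ = suc (column s)

  column-suc : ∀ s → column (suc s) ≡ column s ⊎ column (suc s) ≡ suc (column s)
  column-suc s with stepDirection s ≟ᴹ cellType (column s)
  ... | yes _ = inj₁ refl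
  ... | no  _ = inj₂ refl

  cellType-column-suc : ∀ s → cellType (column (suc s)) ≡ stepDirection s
  cellType-column-suc s with stepDirection s ≟ᴹ cellType (column s)
  ... | yes same = sym same
  ... | no  diff = sym (≢⇒≡opposite diff)

  step-fits-column : ∀ s → Step (cellType (column (suc s))) (v s) (v (suc s))
  step-fits-column s = subst (λ d → Step d (v s) (v (suc s))) (sym (cellType-column-suc s))
    (Step-direction (adjacent-distinct s))

  column-≤-suc : ∀ s → column s ≤ column (suc s)
  column-≤-suc s with column-suc s
  ... | inj₁ eq = subst (column s ≤_) (sym eq) ≤-refl
  ... | inj₂ eq = subst (column s ≤_) (sym eq) (n≤1+n _)

  column-1≤1 : column 1 ≤ 1
  column-1≤1 with column-suc 0
  ... | inj₁ eq = subst (_≤ 1) (sym eq) z≤n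
  ... | inj₂ eq = ≤-reflexive eq

  column-mono : ∀ {i j} → i ≤ j → column i ≤ column j
  column-mono {j = zero} z≤n = ≤-refl
  column-mono {j = suc j} i≤1+j with m≤n⇒m<n∨m≡n i≤1+j
  ... | inj₁ (s≤s i≤j) = ≤-trans (column-mono i≤j) (column-≤-suc j)
  ... | inj₂ refl      = ≤-refl

  same-column⇒Step : ∀ {i j} → i < j → column i ≡ column j → Step (cellType (column i)) (v i) (v j)
  same-column⇒Step {i} {suc j} (s≤s i≤j) ci≡c1+j = prepend (m≤n⇒m<n∨m≡n i≤j)
    where
    last-step : Step (cellType (column i)) (v j) (v (suc j))
    last-step = subst (λ c → Step (cellType c) (v j) (v (suc j))) (sym ci≡c1+j) (step-fits-column j)

    prepend : i < j ⊎ i ≡ j → Step (cellType (column i)) (v i) (v (suc j))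
    prepend (inj₁ i<j) = Step-trans (cellType (column i)) (same-column⇒Step i<j ci≡cj) last-step
      where
      ci≡cj : column i ≡ column j
      ci≡cj = ≤-antisym (column-mono i≤j) (subst (column j ≤_) (sym ci≡c1+j) (column-≤-suc j))
    prepend (inj₂ i≡j) =
      subst (λ k → Step (cellType (column i)) (v k) (v (suc j))) (sym i≡j) last-step

  Alternating : ℕ → (ℕ → ℕ) → ℕ → Set
  Alternating c pos k = ∀ j → j < k →
    pos j < pos (suc j) × Step (cellType (c + j)) (v (pos j)) (v (pos (suc j)))

  Alternating-≤ : ∀ {c pos k l} → Alternating c pos k → l ≤ k → Alternating c pos l
  Alternating-≤ {c} {pos} alt l≤k j j<l = alt j (<-≤-trans j<l l≤k)

  Alternating-snoc : ∀ {c pos k x} → Alternating c pos k → pos k < x →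
    Step (cellType (c + k)) (v (pos k)) (v x) → Alternating c (snoc pos (suc k) x) (suc k)
  Alternating-snoc {c} {pos} {k} {x} alt pk<x last-step j j<1+k with m≤n⇒m<n∨m≡n (≤-pred j<1+k)
  ... | inj₁ j<k rewrite snoc-< pos x (<-trans j<k (n<1+n k)) | snoc-< pos x (s≤s j<k) = alt j j<k
  ... | inj₂ refl rewrite snoc-< pos x (n<1+n k) | snoc-≡ pos (suc k) x = pk<x , last-step

  Alternating⇒increasing : ∀ {c pos k i j} → Alternating c pos k → i < j → j ≤ k → pos i < pos j
  Alternating⇒increasing {c} {pos} {j = suc j} alt (s≤s i≤j) 1+j≤k with m≤n⇒m<n∨m≡n i≤j
  ... | inj₁ i<j  = <-trans (Alternating⇒increasing {c} {pos} alt i<j (≤-trans (n≤1+n j) 1+j≤k))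
                            (proj₁ (alt j 1+j≤k))
  ... | inj₂ refl = proj₁ (alt j 1+j≤k)

  -- The greedy alternating subsequence of v 0 … v p: a step that continues the current run
  -- replaces its last entry, a step that turns appends one, so that its length follows column p.
  record ZigzagChain (p : ℕ) : Set where
    field
      len         : ℕ
      pos         : ℕ → ℕ
      alternating : Alternating (column 1) pos (suc len)
      pos-last    : pos (suc len) ≡ p
      column-last : column p ≡ column 1 + len

  initialChain : ZigzagChain 1
  initialChain = record
    { len = 0 ; pos = id ; alternating = first-step ; pos-last = refl
    ; column-last = sym (+-identityʳ (column 1)) }
    where
    first-step : Alternating (column 1) id 1
    first-step zero    _        =
      n<1+n 0 , subst (λ c → Step (cellType c) (v 0) (v 1)) (sym (+-identityʳ (column 1))) (step-fits-column 0)
    first-step (suc _) (s≤s ())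

  replaceLast : ∀ {p} → ZigzagChain p → column (suc p) ≡ column p → ZigzagChain (suc p)
  replaceLast record { len = len ; pos = pos ; alternating = alt ; pos-last = refl ; column-last = col-p }
              stay =
    record { len = len ; pos = snoc pos (suc len) (suc p) ; alternating = alternating
           ; pos-last = snoc-≡ pos (suc len) (suc p) ; column-last = trans stay col-p }
    where
    p = pos (suc len)

    into-p : pos len < p × Step (cellType (column 1 + len)) (v (pos len)) (v p)
    into-p = alt len (n<1+n len)

    out-of-p : Step (cellType (column 1 + len)) (v p) (v (suc p))
    out-of-p = subst (λ c → Step (cellType c) (v p) (v (suc p))) (trans stay col-p) (step-fits-column p)

    alternating : Alternating (column 1) (snoc pos (suc len) (suc p)) (suc len)
    alternating = Alternating-snoc {column 1} {pos} (Alternating-≤ {column 1} {pos} alt (n≤1+n len))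
      (<-trans (proj₁ into-p) (n<1+n p)) (Step-trans (cellType (column 1 + len)) (proj₂ into-p) out-of-p)

  appendStep : ∀ {p} → ZigzagChain p → column (suc p) ≡ suc (column p) → ZigzagChain (suc p)
  appendStep record { len = len ; pos = pos ; alternating = alt ; pos-last = refl ; column-last = col-p }
             advance =
    record { len = suc len ; pos = snoc pos (suc (suc len)) (suc p)
           ; alternating = Alternating-snoc {column 1} {pos} alt (n<1+n p) out-of-p
           ; pos-last = snoc-≡ pos (suc (suc len)) (suc p) ; column-last = column-1+p }
    where
    p = pos (suc len)

    column-1+p : column (suc p) ≡ column 1 + suc len
    column-1+p = trans advance (trans (cong suc col-p) (sym (+-suc (column 1) len)))

    out-of-p : Step (cellType (column 1 + suc len)) (v p) (v (suc p))
    out-of-p = subst (λ c → Step (cellType c) (v p) (v (suc p))) column-1+p (step-fits-column p)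

  chainAt : ∀ p → ZigzagChain (suc p)
  chainAt zero    = initialChain
  chainAt (suc p) with column-suc (suc p)
  ... | inj₁ stay    = replaceLast (chainAt p) stay
  ... | inj₂ advance = appendStep (chainAt p) advance

increasing⇒injective : ∀ {m n} {f : Fin m → Fin n} →
  (∀ i j → i Fin.< j → f i Fin.< f j) → Injective _≡_ _≡_ f
increasing⇒injective {f = f} increasing {i} {j} fi≡fj with Finₚ.<-cmp i j
... | tri< i<j _ _ = contradiction (cong toℕ fi≡fj) (<⇒≢ (increasing i j i<j))
... | tri≈ _ i≡j _ = i≡j
... | tri> _ _ j<i = contradiction (cong toℕ (sym fi≡fj)) (<⇒≢ (increasing j i j<i))

-- Past the last position the values continue as the identity, which keeps adjacent values distinct.
values : ∀ {n} → Perm n → ℕ → ℕ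
values {n} π i with i <? n
... | yes i<n = toℕ (fun π (fromℕ< i<n))
... | no  _   = i

values-toℕ : ∀ {n} (π : Perm n) (i : Fin n) → values π (toℕ i) ≡ toℕ (fun π i)
values-toℕ {n} π i with toℕ i <? n
... | yes i<n = cong (toℕ ∘ fun π) (fromℕ<-toℕ i i<n)
... | no  i≮n = contradiction (toℕ<n i) i≮n

values-adjacent-distinct : ∀ {n} (π : Perm n) s → values π s ≢ values π (suc s)
values-adjacent-distinct {n} π s with s <? n | suc s <? n
... | yes s<n | yes 1+s<n = λ eq → <⇒≢ (n<1+n s)
      (trans (sym (toℕ-fromℕ< s<n)) (trans (cong toℕ (inj π (toℕ-injective eq))) (toℕ-fromℕ< 1+s<n)))
... | yes s<n | no  1+s≮n = <⇒≢ (<-≤-trans (toℕ<n (fun π (fromℕ< s<n))) (≮⇒≥ 1+s≮n))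
... | no  s≮n | yes 1+s<n = contradiction (<-trans (n<1+n s) 1+s<n) s≮n
... | no  _   | no  _     = <⇒≢ (n<1+n s)

ZigzagPatterns≤ : ℕ → ∀ {n} → Perm n → Set
ZigzagPatterns≤ B π = ∀ {m} (σ : Perm m) → σ ≼ π → Zigzag σ → m ≤ B

module _ {n} (π : Perm n) where
  open Runs (values π) (values-adjacent-distinct π)

  alternating-zigzag-pattern : ∀ {c pos k} → Alternating c pos k → pos k < n →
    Σ (Perm (suc k)) λ σ → σ ≼ π × Zigzag σ
  alternating-zigzag-pattern {c} {pos} {k} alt pos-k<n = σ , (f , f-increasing , order) , zigzag
    where
    in-range : ∀ j → j ≤ k → pos j < n
    in-range j j≤k with m≤n⇒m<n∨m≡n j≤k
    ... | inj₁ j<k  = <-trans (Alternating⇒increasing {c} {pos} alt j<k ≤-refl) pos-k<n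
    ... | inj₂ refl = pos-k<n

    f : Fin (suc k) → Fin n
    f j = fromℕ< (in-range (toℕ j) (≤-pred (toℕ<n j)))

    toℕ-f : ∀ j → toℕ (f j) ≡ pos (toℕ j)
    toℕ-f j = toℕ-fromℕ< (in-range (toℕ j) (≤-pred (toℕ<n j)))

    f-increasing : ∀ i j → i Fin.< j → f i Fin.< f j
    f-increasing i j i<j rewrite toℕ-f i | toℕ-f j =
      Alternating⇒increasing {c} {pos} alt i<j (≤-pred (toℕ<n j))

    w : Fin (suc k) → ℕ
    w j = toℕ (fun π (f j))

    w-injective : Injective _≡_ _≡_ w
    w-injective eq = increasing⇒injective f-increasing (inj π (toℕ-injective eq))

    open Flatten w w-injective using () renaming (flatten to σ; flatten-order to order)

    value : Fin (suc k) → ℕ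
    value j = values π (pos (toℕ j))

    σ<⇒value< : ∀ i j → fun σ i Fin.< fun σ j → value i < value j
    σ<⇒value< i j σi<σj = subst₂ _<_ (w≡value i) (w≡value j) (proj₁ (order i j) σi<σj)
      where
      w≡value : ∀ j → w j ≡ value j
      w≡value j = trans (sym (values-toℕ π (f j))) (cong (values π) (toℕ-f j))

    step-at : ∀ i j → toℕ j ≡ suc (toℕ i) → Step (cellType (c + toℕ i)) (value i) (value j)
    step-at i j j≡1+i =
      subst (λ t → Step (cellType (c + toℕ i)) (value i) (values π (pos t))) (sym j≡1+i)
        (proj₂ (alt (toℕ i) (subst (_≤ k) j≡1+i (≤-pred (toℕ<n j)))))

    zigzag : Zigzag σ
    zigzag i j l j≡1+i l≡1+j =
        (λ (σi<σj , σj<σl) → proj₁ turn (σ<⇒value< i j σi<σj , σ<⇒value< j l σj<σl))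
      , (λ (σj<σi , σl<σj) → proj₂ turn (σ<⇒value< j i σj<σi , σ<⇒value< l j σl<σj))
      where
      d = cellType (c + toℕ i)

      second-step : Step (opposite d) (value j) (value l)
      second-step = subst (λ t → Step (cellType t) (value j) (value l))
        (trans (cong (c +_) j≡1+i) (+-suc c (toℕ i))) (step-at j l l≡1+j)

      turn = turn-nonmonotone d (step-at i j j≡1+i) second-step

  column-bounded : ∀ {B} → ZigzagPatterns≤ B π → ∀ p → p < n → column p ≤ B
  column-bounded bounded zero    _     = z≤n
  column-bounded bounded (suc p) 1+p<n =
    ≤-trans column≤1+len (≤-trans (n≤1+n (suc len)) (bounded σ σ≼π zigzag))
    where
    open ZigzagChain (chainAt p)

    column≤1+len : column (suc p) ≤ suc len
    column≤1+len = ≤-trans (≤-reflexive column-last) (+-monoˡ-≤ len column-1≤1)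

    zigzag-pattern : Σ (Perm (suc (suc len))) λ σ → σ ≼ π × Zigzag σ
    zigzag-pattern =
      alternating-zigzag-pattern {column 1} {pos} alternating (subst (_< n) (sym pos-last) 1+p<n)

    σ = proj₁ zigzag-pattern
    σ≼π = proj₁ (proj₂ zigzag-pattern)
    zigzag = proj₂ (proj₂ zigzag-pattern)

  in-grid : ∀ {B} → ZigzagPatterns≤ B π → InGrid (λ (c : Fin (suc B)) → cellType (toℕ c)) π
  in-grid {B} bounded = col , col-mono , cell
    where
    column<1+B : ∀ (i : Fin n) → column (toℕ i) < suc B
    column<1+B i = s≤s (column-bounded bounded (toℕ i) (toℕ<n i))

    col : Fin n → Fin (suc B)
    col i = fromℕ< (column<1+B i)

    toℕ-col : ∀ i → toℕ (col i) ≡ column (toℕ i)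
    toℕ-col i = toℕ-fromℕ< (column<1+B i)

    col-mono : ∀ i j → i Fin.≤ j → col i Fin.≤ col j
    col-mono i j i≤j rewrite toℕ-col i | toℕ-col j = column-mono i≤j

    cell : ∀ i j → i Fin.< j → col i ≡ col j → CellOrder (cellType (toℕ (col i))) (fun π i) (fun π j)
    cell i j i<j ci≡cj rewrite toℕ-col i =
      Step⇒CellOrder (cellType (column (toℕ i)))
        (subst₂ (Step (cellType (column (toℕ i)))) (values-toℕ π i) (values-toℕ π j)
          (same-column⇒Step i<j (trans (sym (toℕ-col i)) (trans (cong toℕ ci≡cj) (toℕ-col j)))))

zigzags-bounded : (C : PermSet) → FinitelyManyZigzags C →
  Σ ℕ λ B → ∀ {m} (σ : Perm m) → C σ → Zigzag σ → m ≤ B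
zigzags-bounded C (L , complete) = max 0 (map proj₁ L) , λ σ σ∈C zigzag →
  v≤max⁺ 0 (map proj₁ L)
    (inj₂ (map⁺ (Any.map (λ (length≡ , _) → ≤-reflexive (sym length≡)) (complete σ σ∈C zigzag))))

proposition3p1 : (C : PermSet) → IsClass C → FinitelyManyZigzags C →
    Σ ℕ λ k → Σ (Fin k → Mono) λ M → ∀ {n} (π : Perm n) → C π → InGrid M π
proposition3p1 C closed finite =
  let B , bounded = zigzags-bounded C finite in
  suc B , (λ c → cellType (toℕ c)) , λ π π∈C → in-grid π (λ σ σ≼π → bounded σ (closed σ π π∈C σ≼π))
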